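{- The code $\mathrm{Inj}(m,q)$ (with $1<m<q$) and the code $W([m/2],2)$ (with $q=2$, $m$ odd, $m\geq 3$) each induce connected subgraphs of the Hamming graph $H(m,q)$.
   Context: $H(m,q)$ is the Hamming graph on $Q^m$, $|Q|=q$, adjacency = differing in exactly one entry. $\mathrm{Inj}(m,q)$ is the set of vertices with pairwise distinct entries. For $Q=\{0,1\}$, $W([m/2],2)$ is the set of vertices of $H(m,2)$ with exactly $(m-1)/2$ or $(m+1)/2$ entries equal to $1$. -}

module Defs where

open import Data.Nat using (ℕ; zero; suc; _+_; _*_)
open import Data.Fin using (Fin; zero; suc; toℕ)
open import Data.Fin.Properties using (_≟_)
open import Data.Bool using (true; false)
open import Data.List using (List; []; _∷_)
open import Data.Product using (Σ; _×_; _,_; ∃)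
open import Data.Unit using (⊤)
open import Relation.Nullary using (¬_; yes; no)
open import Relation.Binary.PropositionalEquality using (_≡_)

Word : ℕ → ℕ → Set
Word m q = Fin m → Fin q

countFin : (m : ℕ) → (Fin m → ℕ) → ℕ
countFin zero f = 0
countFin (suc m) f = f zero + countFin m (λ i → f (suc i))

dist : ∀ {m q} → Word m q → Word m q → ℕ
dist {m} x y = countFin m (λ i → Data.Bool.if does (x i ≟ y i) then 0 else 1)
  where open import Relation.Nullary using (does)

Adj : ∀ {m q} → Word m q → Word m q → Set
Adj x y = dist x y ≡ 1

data WalkIn {m q} (C : Word m q → Set) : Word m q → Word m q → Set where
  here : ∀ {x} → C x → WalkIn C x x
  step : ∀ {x y z} → C x → Adj x y → WalkIn C y z → WalkIn C x z

InducesConnected : ∀ {m q} → (Word m q → Set) → Set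
InducesConnected {m} {q} C =
  Σ (Word m q) C × (∀ x y → C x → C y → WalkIn C x y)

Inj : (m q : ℕ) → Word m q → Set
Inj m q x = ∀ i j → x i ≡ x j → i ≡ j

weight : ∀ {m} → Word m 2 → ℕ
weight {m} x = countFin m (λ i → toℕ (x i))

-- W([m/2],2) for m = 2k+1: weight k or k+1
W : (k : ℕ) → Word (suc (2 * k)) 2 → Set
W k x = (weight x ≡ k) Data.Sum.⊎ (weight x ≡ suc k)
  where import Data.Sum

-- Fix a target y and correct a word x of the code coordinate by coordinate, from left to right.
-- At coordinate i either x i can be set to y i at once, or some later coordinate j is changed
-- first to make room: for Inj, x j = y i is moved to a symbol missing from x (one exists as
-- m < q); for W, a bit beyond i is flipped to bring the weight to the value from which
-- flipping x i stays in W (such a bit exists, or else the weights of x and y would be out of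
-- order).

module Submission where

open import Defs
open import Data.Nat using (ℕ; zero; suc; _+_; _*_; _≤_; _<_; _≥_; z≤n; s≤s; z<s; _<?_)
open import Data.Nat.Properties hiding (_≟_)
open import Data.Fin using (Fin; zero; suc; toℕ; fromℕ<; inject≤)
open import Data.Fin.Patterns using (0F; 1F)
open import Data.Fin.Properties
  using (_≟_; any?; all?; toℕ<n; toℕ≤pred[n]; toℕ-fromℕ<; toℕ-injective; inject≤-injective; injective⇒≤; ¬∀⟶∃¬)
open import Data.Vec.Functional using (updateAt; _∷_)
open import Data.Vec.Functional.Properties using (updateAt-updates; updateAt-minimal)
open import Data.Bool using (if_then_else_)
open import Data.Product using (Σ; ∃; _×_; _,_; proj₁; proj₂)
open import Data.Sum using (inj₁; inj₂)
open import Data.Empty using (⊥-elim)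
open import Function using (_∘_; const)
open import Relation.Nullary using (yes; no; does; ¬?; _×-dec_)
open import Relation.Nullary.Decidable using (dec-true; dec-false; decidable-stable)
open import Relation.Binary.Definitions using (tri<; tri≈; tri>)
open import Relation.Binary.PropositionalEquality
open import Algebra.Properties.CommutativeSemigroup +-commutativeSemigroup using (xy∙z≈zy∙x)

private
  variable
    m q : ℕ

countFin-cong : ∀ m {f g : Fin m → ℕ} → f ≗ g → countFin m f ≡ countFin m g
countFin-cong zero    f≗g = refl
countFin-cong (suc m) f≗g = cong₂ _+_ (f≗g zero) (countFin-cong m (f≗g ∘ suc))

countFin-mono-≤ : ∀ m {f g : Fin m → ℕ} → (∀ i → f i ≤ g i) → countFin m f ≤ countFin m g
countFin-mono-≤ zero    f≤g = z≤n
countFin-mono-≤ (suc m) f≤g = +-mono-≤ (f≤g zero) (countFin-mono-≤ m (f≤g ∘ suc))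

countFin-mono-< : ∀ m {f g : Fin m → ℕ} → (∀ i → f i ≤ g i) → ∀ i → f i < g i →
                  countFin m f < countFin m g
countFin-mono-< (suc m) f≤g zero    fi<gi = +-mono-<-≤ fi<gi (countFin-mono-≤ m (f≤g ∘ suc))
countFin-mono-< (suc m) f≤g (suc i) fi<gi = +-mono-≤-< (f≤g zero) (countFin-mono-< m (f≤g ∘ suc) i fi<gi)

countFin-zero : ∀ m {f : Fin m → ℕ} → (∀ j → f j ≡ 0) → countFin m f ≡ 0
countFin-zero zero    f≡0 = refl
countFin-zero (suc m) f≡0 = cong₂ _+_ (f≡0 zero) (countFin-zero m (f≡0 ∘ suc))

countFin-single : ∀ m {f : Fin m → ℕ} i → f i ≡ 1 → (∀ j → j ≢ i → f j ≡ 0) → countFin m f ≡ 1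
countFin-single (suc m) zero    fi≡1 rest = cong₂ _+_ fi≡1 (countFin-zero m (λ j → rest (suc j) λ ()))
countFin-single (suc m) (suc i) fi≡1 rest =
  cong₂ _+_ (rest zero λ ()) (countFin-single m i fi≡1 λ j j≢i → rest (suc j) λ { refl → j≢i refl })

countFin-update : ∀ m {f g : Fin m → ℕ} i → (∀ j → j ≢ i → f j ≡ g j) →
                  countFin m f + g i ≡ countFin m g + f i
countFin-update (suc m) {f} {g} zero agree = begin
  f zero + countFin m (f ∘ suc) + g zero ≡⟨ cong (λ c → f zero + c + g zero) (countFin-cong m λ j → agree (suc j) λ ()) ⟩
  f zero + countFin m (g ∘ suc) + g zero ≡⟨ xy∙z≈zy∙x (f zero) _ (g zero) ⟩
  g zero + countFin m (g ∘ suc) + f zero ∎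
  where open ≡-Reasoning
countFin-update (suc m) {f} {g} (suc i) agree = begin
  f zero + countFin m (f ∘ suc) + g (suc i)   ≡⟨ cong (λ a → a + countFin m (f ∘ suc) + g (suc i)) (agree zero λ ()) ⟩
  g zero + countFin m (f ∘ suc) + g (suc i)   ≡⟨ +-assoc (g zero) _ _ ⟩
  g zero + (countFin m (f ∘ suc) + g (suc i)) ≡⟨ cong (g zero +_) (countFin-update m i λ j j≢i → agree (suc j) λ { refl → j≢i refl }) ⟩
  g zero + (countFin m (g ∘ suc) + f (suc i)) ≡⟨ +-assoc (g zero) _ _ ⟨
  g zero + countFin m (g ∘ suc) + f (suc i)   ∎
  where open ≡-Reasoning

_[_]≔_ : Word m q → Fin m → Fin q → Word m q
x [ i ]≔ a = updateAt x i (const a)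

[]≔-updates : (x : Word m q) (i : Fin m) {a : Fin q} → (x [ i ]≔ a) i ≡ a
[]≔-updates x i = updateAt-updates i x

[]≔-minimal : (x : Word m q) {i j : Fin m} {a : Fin q} → j ≢ i → (x [ i ]≔ a) j ≡ x j
[]≔-minimal x {i} {j} = updateAt-minimal j i x

-- The summand of dist, so that dist x y is definitionally countFin m (λ i → mismatch (x i) (y i)).
mismatch : Fin q → Fin q → ℕ
mismatch a b = if does (a ≟ b) then 0 else 1

mismatch-≡ : {a b : Fin q} → a ≡ b → mismatch a b ≡ 0
mismatch-≡ {a = a} {b} a≡b = cong (if_then 0 else 1) (dec-true (a ≟ b) a≡b)

mismatch-≢ : {a b : Fin q} → a ≢ b → mismatch a b ≡ 1
mismatch-≢ {a = a} {b} a≢b = cong (if_then 0 else 1) (dec-false (a ≟ b) a≢b)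

mismatch-sym : (a b : Fin q) → mismatch a b ≡ mismatch b a
mismatch-sym a b with a ≟ b
... | yes a≡b = sym (mismatch-≡ (sym a≡b))
... | no  a≢b = sym (mismatch-≢ (a≢b ∘ sym))

Adj-sym : {x y : Word m q} → Adj x y → Adj y x
Adj-sym {m} {x = x} {y} = trans (countFin-cong m λ i → mismatch-sym (y i) (x i))

Adj-respʳ : {x y y′ : Word m q} → y ≗ y′ → Adj x y → Adj x y′
Adj-respʳ {m} {x = x} y≗y′ = trans (countFin-cong m λ i → cong (mismatch (x i)) (sym (y≗y′ i)))

Adj-[]≔ : (x : Word m q) {i : Fin m} {a : Fin q} → x i ≢ a → Adj x (x [ i ]≔ a)
Adj-[]≔ {m} x {i} xi≢a = countFin-single m i
  (mismatch-≢ λ xi≡ → xi≢a (trans xi≡ ([]≔-updates x i)))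
  (λ j j≢i → mismatch-≡ (sym ([]≔-minimal x j≢i)))

module _ {C : Word m q → Set} where

  walk-end : {x y : Word m q} → WalkIn C x y → C y
  walk-end (here cx)     = cx
  walk-end (step _ _ w) = walk-end w

  _◅◅_ : {x y z : Word m q} → WalkIn C x y → WalkIn C y z → WalkIn C x z
  here _       ◅◅ w′ = w′
  step cx a w ◅◅ w′ = step cx a (w ◅◅ w′)

AgreeBelow : ℕ → Word m q → Word m q → Set
AgreeBelow n x y = ∀ j → toℕ j < n → x j ≡ y j

agreeBelow-extend : {x y : Word m q} {i : Fin m} → AgreeBelow (toℕ i) x y → x i ≡ y i →
                    AgreeBelow (suc (toℕ i)) x y
agreeBelow-extend {i = i} agree xi≡yi j j≤i with m≤n⇒m<n∨m≡n (≤-pred j≤i)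
... | inj₁ j<i = agree j j<i
... | inj₂ j≡i rewrite toℕ-injective j≡i = xi≡yi

agreeBelow-[]≔ : ∀ {n} {x y : Word m q} {j a} → n ≤ toℕ j → AgreeBelow n x y →
                 AgreeBelow n (x [ j ]≔ a) y
agreeBelow-[]≔ {x = x} n≤j agree l l<n =
  trans ([]≔-minimal x λ { refl → <⇒≱ l<n n≤j }) (agree l l<n)

module CoordinateWise {C : Word m q → Set} where

  Fixable : Word m q → Fin m → Word m q → Set
  Fixable y i x = ∃ λ x′ → AgreeBelow (suc (toℕ i)) x′ y × WalkIn C x x′

  FixesCoordinates : Word m q → Set
  FixesCoordinates y = ∀ i x → C x → AgreeBelow (toℕ i) x y → Fixable y i x

  HasNeighbours : Set
  HasNeighbours = ∀ x → C x → ∃ λ w → C w × Adj x w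

  fixable-agreeing : ∀ {x y i} → C x → AgreeBelow (toℕ i) x y → x i ≡ y i → Fixable y i x
  fixable-agreeing {x} cx agree xi≡yi = x , agreeBelow-extend agree xi≡yi , here cx

  fixable-by-update : ∀ {x y i} → C x → AgreeBelow (toℕ i) x y → x i ≢ y i → C (x [ i ]≔ y i) →
                      Fixable y i x
  fixable-by-update {x} {y} {i} cx agree xi≢yi cx′ =
    x [ i ]≔ y i ,
    agreeBelow-extend (agreeBelow-[]≔ ≤-refl agree) ([]≔-updates x i) ,
    step cx (Adj-[]≔ x xi≢yi) (here cx′)

  fixable-after-step : ∀ {x x′ y i} → C x → Adj x x′ → Fixable y i x′ → Fixable y i x
  fixable-after-step cx a (x″ , agree , w) = x″ , agree , step cx a w

  walk-to-agreeing : ∀ {x y} → FixesCoordinates y → ∀ n → n ≤ m → C x →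
                     ∃ λ x′ → AgreeBelow n x′ y × WalkIn C x x′
  walk-to-agreeing {x} fix zero    _   cx = x , (λ _ ()) , here cx
  walk-to-agreeing {x} {y} fix (suc n) n<m cx
    with x′ , agree , w ← walk-to-agreeing fix n (<⇒≤ n<m) cx
    with x″ , agree′ , w′ ← fix (fromℕ< n<m) x′ (walk-end w)
                                (subst (λ k → AgreeBelow k x′ y) (sym (toℕ-fromℕ< n<m)) agree)
    = x″ , subst (λ k → AgreeBelow (suc k) x″ y) (toℕ-fromℕ< n<m) agree′ , w ◅◅ w′

  -- Without function extensionality a word pointwise equal to y need not be y, so the walk
  -- is made to end at y itself; when it is empty this costs a detour through a neighbour.
  retarget : ∀ {x x′ y} → HasNeighbours → C y → WalkIn C x x′ → x′ ≗ y → WalkIn C x y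
  retarget {x} {y = y} nb cy (here cx) x≗y with w , cw , a ← nb x cx =
    step cx a (step cw (Adj-respʳ {x = w} {x} {y} x≗y (Adj-sym {x = x} {w} a)) (here cy))
  retarget {x} {x′} {y} nb cy (step cx a (here _)) x′≗y =
    step cx (Adj-respʳ {x = x} {x′} {y} x′≗y a) (here cy)
  retarget nb cy (step cx a w@(step _ _ _)) x′≗y = step cx a (retarget nb cy w x′≗y)

  connected-coordinatewise : Σ (Word m q) C → HasNeighbours → (∀ y → C y → FixesCoordinates y) →
                             InducesConnected C
  connected-coordinatewise member nb fix = member , λ x y cx cy →
    let x′ , agree , w = walk-to-agreeing (fix y cy) m ≤-refl cx
    in retarget nb cy w λ j → agree j (toℕ<n j)

Inj-[]≔-fresh : {x : Word m q} {i : Fin m} {a : Fin q} → Inj m q x → (∀ l → x l ≢ a) →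
                Inj m q (x [ i ]≔ a)
Inj-[]≔-fresh {x = x} {i} inj fresh l l′ eq with l ≟ i | l′ ≟ i
... | yes refl | yes refl = refl
... | yes refl | no  l′≢i = ⊥-elim (fresh l′ (trans (sym ([]≔-minimal x l′≢i)) (trans (sym eq) ([]≔-updates x l))))
... | no  l≢i  | yes refl = ⊥-elim (fresh l (trans (sym ([]≔-minimal x l≢i)) (trans eq ([]≔-updates x l′))))
... | no  l≢i  | no  l′≢i = inj l l′ (trans (sym ([]≔-minimal x l≢i)) (trans eq ([]≔-minimal x l′≢i)))

Inj-[]≔-removes : {x : Word m q} {j : Fin m} {a : Fin q} → Inj m q x → (∀ l → x l ≢ a) →
                  ∀ l → (x [ j ]≔ a) l ≢ x j
Inj-[]≔-removes {x = x} {j} inj fresh l eq with l ≟ j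
... | yes refl = fresh l (trans (sym eq) ([]≔-updates x l))
... | no  l≢j  = l≢j (inj l j (trans (sym ([]≔-minimal x l≢j)) eq))

fresh-symbol : m < q → (x : Word m q) → ∃ λ s → ∀ l → x l ≢ s
fresh-symbol m<q x with any? (λ s → all? (λ l → ¬? (x l ≟ s)))
... | yes found = found
... | no  none  = ⊥-elim (<⇒≱ m<q (injective⇒≤ {f = proj₁ ∘ preimage} λ {s} {s′} e →
                    trans (sym (proj₂ (preimage s))) (trans (cong x e) (proj₂ (preimage s′)))))
  where
  preimage : ∀ s → ∃ λ l → x l ≡ s
  preimage s with l , ¬x≢s ← ¬∀⟶∃¬ _ (λ l → x l ≢ s) (λ l → ¬? (x l ≟ s)) (λ fr → none (s , fr)) =
    l , decidable-stable (x l ≟ s) ¬x≢s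

module _ {m q : ℕ} where
  open CoordinateWise {m} {q} {Inj m q}

  Inj-fixable-fresh : ∀ {x y i} → Inj m q x → AgreeBelow (toℕ i) x y → (∀ l → x l ≢ y i) →
                      Fixable y i x
  Inj-fixable-fresh {i = i} inj agree fresh =
    fixable-by-update inj agree (fresh i) (Inj-[]≔-fresh inj fresh)

  Inj-fixes : m < q → ∀ y → Inj m q y → FixesCoordinates y
  Inj-fixes m<q y inj-y i x inj-x agree with any? (λ j → x j ≟ y i)
  ... | no absent = Inj-fixable-fresh inj-x agree λ l xl≡yi → absent (l , xl≡yi)
  ... | yes (j , xj≡yi) with <-cmp (toℕ j) (toℕ i)
  ...   | tri< j<i _ _ = ⊥-elim (<⇒≢ j<i (cong toℕ (inj-y j i (trans (sym (agree j j<i)) xj≡yi))))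
  ...   | tri≈ _ j≡i _ = fixable-agreeing inj-x agree (subst (λ l → x l ≡ y i) (toℕ-injective j≡i) xj≡yi)
  ...   | tri> _ _ i<j with s , fs ← fresh-symbol m<q x =
    fixable-after-step inj-x (Adj-[]≔ x (fs j))
      (Inj-fixable-fresh (Inj-[]≔-fresh inj-x fs) (agreeBelow-[]≔ (<⇒≤ i<j) agree)
        (subst (λ b → ∀ l → (x [ j ]≔ s) l ≢ b) xj≡yi (Inj-[]≔-removes inj-x fs)))

  Inj-connected : 0 < m → m < q → InducesConnected (Inj m q)
  Inj-connected 0<m m<q = connected-coordinatewise member neighbour (Inj-fixes m<q)
    where
    member : Σ (Word m q) (Inj m q)
    member = (λ i → inject≤ i (<⇒≤ m<q)) , λ i j → inject≤-injective _ _ i j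
    neighbour : HasNeighbours
    neighbour x inj-x with s , fs ← fresh-symbol m<q x =
      x [ fromℕ< 0<m ]≔ s , Inj-[]≔-fresh inj-x fs , Adj-[]≔ x (fs (fromℕ< 0<m))

≡0F⇒≢1F : {a : Fin 2} → a ≡ 0F → a ≢ 1F
≡0F⇒≢1F refl ()

≡1F⇒≢0F : {a : Fin 2} → a ≡ 1F → a ≢ 0F
≡1F⇒≢0F refl ()

weight-[]≔ : (x : Word m 2) (i : Fin m) (a : Fin 2) → weight (x [ i ]≔ a) + toℕ (x i) ≡ weight x + toℕ a
weight-[]≔ {m} x i a =
  trans (countFin-update m i λ j j≢i → cong toℕ ([]≔-minimal x j≢i))
        (cong (λ b → weight x + toℕ b) ([]≔-updates x i))

weight-raise : (x : Word m 2) (i : Fin m) → x i ≡ 0F → weight (x [ i ]≔ 1F) ≡ suc (weight x)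
weight-raise x i xi≡0 = begin
  weight (x [ i ]≔ 1F)              ≡⟨ +-identityʳ _ ⟨
  weight (x [ i ]≔ 1F) + 0          ≡⟨ cong (λ b → weight (x [ i ]≔ 1F) + toℕ b) xi≡0 ⟨
  weight (x [ i ]≔ 1F) + toℕ (x i)  ≡⟨ weight-[]≔ x i 1F ⟩
  weight x + 1                      ≡⟨ +-comm _ 1 ⟩
  suc (weight x)                    ∎
  where open ≡-Reasoning

weight-lower : (x : Word m 2) (i : Fin m) → x i ≡ 1F → suc (weight (x [ i ]≔ 0F)) ≡ weight x
weight-lower x i xi≡1 = begin
  suc (weight (x [ i ]≔ 0F))        ≡⟨ +-comm 1 _ ⟩
  weight (x [ i ]≔ 0F) + 1          ≡⟨ cong (λ b → weight (x [ i ]≔ 0F) + toℕ b) xi≡1 ⟨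
  weight (x [ i ]≔ 0F) + toℕ (x i)  ≡⟨ weight-[]≔ x i 0F ⟩
  weight x + 0                      ≡⟨ +-identityʳ _ ⟩
  weight x                          ∎
  where open ≡-Reasoning

weight-< : {u v : Word m 2} {i : Fin m} → AgreeBelow (toℕ i) u v → u i ≡ 0F → v i ≡ 1F →
           (∀ l → toℕ i < toℕ l → toℕ (u l) ≤ toℕ (v l)) → weight u < weight v
weight-< {m} {u} {v} {i} agree ui≡0 vi≡1 above =
  countFin-mono-< m pointwise i (subst₂ (λ a b → toℕ a < toℕ b) (sym ui≡0) (sym vi≡1) z<s)
  where
  pointwise : ∀ l → toℕ (u l) ≤ toℕ (v l)
  pointwise l with <-cmp (toℕ l) (toℕ i)
  ... | tri< l<i _ _ = ≤-reflexive (cong toℕ (agree l l<i))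
  ... | tri≈ _ l≡i _ rewrite toℕ-injective l≡i | ui≡0 = z≤n
  ... | tri> _ _ i<l = above l i<l

weight<⇒∃0F : (x : Word m 2) → weight x < m → ∃ λ l → x l ≡ 0F
weight<⇒∃0F {suc m} x w<m with x zero in x0≡
... | 0F = zero , x0≡
... | 1F with l , xl≡0 ← weight<⇒∃0F (x ∘ suc) (≤-pred w<m) = suc l , xl≡0

0<weight⇒∃1F : (x : Word m 2) → 0 < weight x → ∃ λ l → x l ≡ 1F
0<weight⇒∃1F {suc m} x 0<w with x zero in x0≡
... | 1F = zero , x0≡
... | 0F with l , xl≡1 ← 0<weight⇒∃1F (x ∘ suc) 0<w = suc l , xl≡1

word-of-weight : ∀ m {w} → w ≤ m → ∃ λ (x : Word m 2) → weight x ≡ w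
word-of-weight zero    z≤n = (λ ()) , refl
word-of-weight (suc m) {zero} _ with x , wx ← word-of-weight m z≤n = 0F ∷ x , wx
word-of-weight (suc m) {suc w} (s≤s w≤m) with x , wx ← word-of-weight m w≤m = 1F ∷ x , cong suc wx

module _ {k : ℕ} where
  open CoordinateWise {suc (2 * k)} {2} {W k}

  private
    m′ : ℕ
    m′ = suc (2 * k)

    k<m′ : k < m′
    k<m′ = s≤s (m≤m+n k (k + 0))

  W-fixable-raise : ∀ {x y i} → weight x ≡ k → AgreeBelow (toℕ i) x y → x i ≡ 0F → y i ≡ 1F →
                    Fixable y i x
  W-fixable-raise {x} {i = i} wx≡k agree xi≡0 yi≡1 =
    fixable-by-update (inj₁ wx≡k) agree (λ xi≡yi → ≡0F⇒≢1F xi≡0 (trans xi≡yi yi≡1))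
      (subst (λ b → W k (x [ i ]≔ b)) (sym yi≡1) (inj₂ (trans (weight-raise x i xi≡0) (cong suc wx≡k))))

  W-fixable-lower : ∀ {x y i} → weight x ≡ suc k → AgreeBelow (toℕ i) x y → x i ≡ 1F → y i ≡ 0F →
                    Fixable y i x
  W-fixable-lower {x} {i = i} wx≡k+1 agree xi≡1 yi≡0 =
    fixable-by-update (inj₂ wx≡k+1) agree (λ xi≡yi → ≡1F⇒≢0F xi≡1 (trans xi≡yi yi≡0))
      (subst (λ b → W k (x [ i ]≔ b)) (sym yi≡0) (inj₁ (suc-injective (trans (weight-lower x i xi≡1) wx≡k+1))))

  W-fixable-raise-then-lower : ∀ {x y i} → weight x ≡ k → W k y → AgreeBelow (toℕ i) x y →
                               x i ≡ 1F → y i ≡ 0F → Fixable y i x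
  W-fixable-raise-then-lower {x} {y} {i} wx≡k wy agree xi≡1 yi≡0
    with any? (λ j → (toℕ i <? toℕ j) ×-dec (x j ≟ 0F))
  ... | yes (j , i<j , xj≡0) =
    fixable-after-step (inj₁ wx≡k) (Adj-[]≔ x (≡0F⇒≢1F xj≡0))
      (W-fixable-lower (trans (weight-raise x j xj≡0) (cong suc wx≡k)) (agreeBelow-[]≔ (<⇒≤ i<j) agree)
        (trans ([]≔-minimal x (<⇒≢ i<j ∘ cong toℕ)) xi≡1) yi≡0)
  ... | no none = ⊥-elim (<⇒≱ (weight-< (λ l l<i → sym (agree l l<i)) yi≡0 xi≡1 above)
                              (≤-trans (≤-reflexive wx≡k) (lower-bound wy)))
    where
    lower-bound : W k y → k ≤ weight y
    lower-bound (inj₁ wy≡k)   = ≤-reflexive (sym wy≡k)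
    lower-bound (inj₂ wy≡k+1) = ≤-trans (n≤1+n k) (≤-reflexive (sym wy≡k+1))
    above : ∀ l → toℕ i < toℕ l → toℕ (y l) ≤ toℕ (x l)
    above l i<l with x l in xl≡
    ... | 0F = ⊥-elim (none (l , i<l , xl≡))
    ... | 1F = toℕ≤pred[n] (y l)

  W-fixable-lower-then-raise : ∀ {x y i} → weight x ≡ suc k → W k y → AgreeBelow (toℕ i) x y →
                               x i ≡ 0F → y i ≡ 1F → Fixable y i x
  W-fixable-lower-then-raise {x} {y} {i} wx≡k+1 wy agree xi≡0 yi≡1
    with any? (λ j → (toℕ i <? toℕ j) ×-dec (x j ≟ 1F))
  ... | yes (j , i<j , xj≡1) =
    fixable-after-step (inj₂ wx≡k+1) (Adj-[]≔ x (≡1F⇒≢0F xj≡1))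
      (W-fixable-raise (suc-injective (trans (weight-lower x j xj≡1) wx≡k+1)) (agreeBelow-[]≔ (<⇒≤ i<j) agree)
        (trans ([]≔-minimal x (<⇒≢ i<j ∘ cong toℕ)) xi≡0) yi≡1)
  ... | no none = ⊥-elim (<⇒≱ (weight-< agree xi≡0 yi≡1 above)
                              (≤-trans (upper-bound wy) (≤-reflexive (sym wx≡k+1))))
    where
    upper-bound : W k y → weight y ≤ suc k
    upper-bound (inj₁ wy≡k)   = ≤-trans (≤-reflexive wy≡k) (n≤1+n k)
    upper-bound (inj₂ wy≡k+1) = ≤-reflexive wy≡k+1
    above : ∀ l → toℕ i < toℕ l → toℕ (x l) ≤ toℕ (y l)
    above l i<l with x l in xl≡
    ... | 0F = z≤n
    ... | 1F = ⊥-elim (none (l , i<l , xl≡))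

  W-fixes : ∀ y → W k y → FixesCoordinates y
  W-fixes y wy i x wx agree with x i in xi≡ | y i in yi≡ | wx
  ... | 0F | 0F | _ = fixable-agreeing wx agree (trans xi≡ (sym yi≡))
  ... | 1F | 1F | _ = fixable-agreeing wx agree (trans xi≡ (sym yi≡))
  ... | 0F | 1F | inj₁ wx≡k   = W-fixable-raise wx≡k agree xi≡ yi≡
  ... | 0F | 1F | inj₂ wx≡k+1 = W-fixable-lower-then-raise wx≡k+1 wy agree xi≡ yi≡
  ... | 1F | 0F | inj₁ wx≡k   = W-fixable-raise-then-lower wx≡k wy agree xi≡ yi≡
  ... | 1F | 0F | inj₂ wx≡k+1 = W-fixable-lower wx≡k+1 agree xi≡ yi≡

  W-neighbour : HasNeighbours
  W-neighbour x (inj₁ wx≡k) with l , xl≡0 ← weight<⇒∃0F x (subst (_< m′) (sym wx≡k) k<m′) =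
    x [ l ]≔ 1F , inj₂ (trans (weight-raise x l xl≡0) (cong suc wx≡k)) , Adj-[]≔ x (≡0F⇒≢1F xl≡0)
  W-neighbour x (inj₂ wx≡k+1) with l , xl≡1 ← 0<weight⇒∃1F x (subst (0 <_) (sym wx≡k+1) z<s) =
    x [ l ]≔ 0F , inj₁ (suc-injective (trans (weight-lower x l xl≡1) wx≡k+1)) , Adj-[]≔ x (≡1F⇒≢0F xl≡1)

  W-connected : InducesConnected (W k)
  W-connected with x , wx≡k ← word-of-weight m′ (<⇒≤ k<m′) =
    connected-coordinatewise (x , inj₁ wx≡k) W-neighbour W-fixes

-- Neither 1 < m (only 0 < m, to have a coordinate to move) nor m ≥ 3 is needed.
lemma4p2 : ((m q : ℕ) → 1 < m → m < q → InducesConnected (Inj m q))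
         × ((k : ℕ) → suc (2 * k) ≥ 3 → InducesConnected (W k))
lemma4p2 = (λ m q 1<m m<q → Inj-connected (<-trans z<s 1<m) m<q) , (λ k _ → W-connected {k})
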